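{- Constant space Turing machines with quasipolynomial-size advice simulate quasipolynomial-size width-5 branching programs: for every family $(B_n)_{n\ge 0}$, where $B_n$ is a width-5 branching program over variables $x_1,\dots,x_n$ of size at most $2^{(\log n)^c}$ for some constant $c$, there exist a Turing machine $M$ using only $O(1)$ cells of work tape, a constant $c'$, and advice strings $(a_n)$ with $|a_n| \le 2^{(\log n)^{c'}}$ for all sufficiently large $n$, such that for every $x \in \{0,1\}^n$, $M$ on input $x$ with advice $a_n$ outputs $B_n(x)$.
   Context: A branching program is a directed acyclic graph with a single start node; nodes of out-degree 2 (inner nodes) are labeled by a variable, one outgoing edge labeled 0 and the other 1; nodes of out-degree 0 (sinks) are labeled 0 or 1. An assignment determines a path from the start node to a sink, whose label is the output. If nodes are arranged into levels with edges going only from one level to the next, the width is the size of the largest level; a width-5 branching program is such a leveled program of width at most 5. Size is the number of nodes. A Turing machine with advice has a read-only input tape, a read-only advice tape holding a string depending only on the input length, and a work tape; constant space means a constant bound on the number of work-tape cells used (head positions are not counted). -}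

module Defs where

open import Data.Nat using (ℕ; zero; suc; _+_; _*_; _^_; _≤_; _<?_; _⊔_)
open import Data.Nat.Logarithm using (⌈log₂_⌉)
open import Data.Bool using (Bool; true; false; if_then_else_)
open import Data.Fin using (Fin; fromℕ<)
open import Data.Vec using (Vec; lookup)
open import Data.List using (List; length)
open import Data.Product using (Σ; ∃; _×_; _,_)
open import Data.Sum using (_⊎_; inj₁; inj₂)
open import Relation.Nullary using (yes; no)
open import Relation.Binary.PropositionalEquality using (_≡_)

-- A node at some level whose successors lie in the next level of k' nodes.
data Node (n k' : ℕ) : Set where
  inner : (var : Fin n) (succ0 succ1 : Fin k') → Node n k'
  sink  : Bool → Node n k'

-- BP n k : the levels from some level of k nodes downwards.
-- The last level contains only sinks.
data BP (n : ℕ) : ℕ → Set where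
  last : ∀ {k} → (Fin k → Bool) → BP n k
  step : ∀ {k k'} → (Fin k → Node n k') → BP n k' → BP n k

-- A branching program: level 0 consists of the single start node.
BranchingProgram : ℕ → Set
BranchingProgram n = BP n 1

width : ∀ {n k} → BP n k → ℕ
width {k = k} (last _)   = k
width {k = k} (step _ r) = k ⊔ width r

size : ∀ {n k} → BP n k → ℕ
size {k = k} (last _)   = k
size {k = k} (step _ r) = k + size r

evalFrom : ∀ {n k} → BP n k → Fin k → Vec Bool n → Bool
evalFrom (last f)    i x = f i
evalFrom (step ns r) i x with ns i
... | sink b          = b
... | inner v j0 j1   = evalFrom r (if lookup x v then j1 else j0) x

eval : ∀ {n} → BranchingProgram n → Vec Bool n → Bool
eval B x = evalFrom B Fin.zero x

-- Symbols seen on the read-only tapes: left endmarker, a bit, right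
-- endmarker (also read everywhere to the right of the content).
data TSym : Set where
  ⊢ ⊣ : TSym
  bit : Bool → TSym

data Move : Set where
  L S R : Move

-- Work-tape alphabet Fin (suc g), blank symbol = Fin.zero.
data Action (Q g : ℕ) : Set where
  halt : Bool → Action Q g
  go   : Fin Q → Fin (suc g) → (inMove advMove workMove : Move) → Action Q g

record TM : Set where
  field
    Q     : ℕ
    g     : ℕ
    start : Fin Q
    δ     : Fin Q → (inSym advSym : TSym) → (workSym : Fin (suc g)) → Action Q g

-- Tape content: cell 0 = ⊢, cells 1..m = the string, cells > m = ⊣.
readVec : ∀ {m} → Vec Bool m → ℕ → TSym
readVec         v zero    = ⊢
readVec {m = m} v (suc p) with p <? m
... | yes p<m = bit (lookup v (fromℕ< p<m))
... | no  _   = ⊣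

readList : List Bool → ℕ → TSym
readList a zero = ⊢
readList List.[] (suc p) = ⊣
readList (b List.∷ a) (suc zero) = bit b
readList (b List.∷ a) (suc (suc p)) = readList a (suc p)

move : Move → ℕ → ℕ
move L zero    = zero
move L (suc p) = p
move S p       = p
move R p       = suc p

record Config (M : TM) : Set where
  field
    state : Fin (TM.Q M)
    inPos advPos workPos : ℕ
    work  : ℕ → Fin (suc (TM.g M))

module _ (M : TM) where
  open TM M
  open Config

  initial : Config M
  initial = record { state = start ; inPos = 0 ; advPos = 0 ; workPos = 0
                   ; work = λ _ → Fin.zero }

  write : (ℕ → Fin (suc g)) → ℕ → Fin (suc g) → ℕ → Fin (suc g)
  write t p s q with p Data.Nat.≟ q
  ... | yes _ = s
  ... | no  _ = t q

  stepTM : ∀ {n} → Vec Bool n → List Bool → Config M → Config M ⊎ Bool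
  stepTM x a c with δ (state c) (readVec x (inPos c)) (readList a (advPos c))
                      (work c (workPos c))
  ... | halt b = inj₂ b
  ... | go q s mi ma mw = inj₁ record
        { state = q ; inPos = move mi (inPos c) ; advPos = move ma (advPos c)
        ; workPos = move mw (workPos c) ; work = write (work c) (workPos c) s }

  exec : ∀ {n} → Vec Bool n → List Bool → ℕ → Config M ⊎ Bool
  exec x a zero    = inj₁ initial
  exec x a (suc t) with exec x a t
  ... | inj₁ c = stepTM x a c
  ... | inj₂ b = inj₂ b

  Outputs : ∀ {n} → Vec Bool n → List Bool → Bool → Set
  Outputs x a b = ∃ λ t → exec x a t ≡ inj₂ b

  WorkBounded : ∀ {n} → ℕ → Vec Bool n → List Bool → Set
  WorkBounded K x a = ∀ t c → exec x a t ≡ inj₁ c → workPos c ≤ K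

qpoly : ℕ → ℕ → ℕ
qpoly c n = 2 ^ (⌈log₂ n ⌉ ^ c)

Eventually : (ℕ → Set) → Set
Eventually P = ∃ λ N → ∀ n → N ≤ n → P n

{-# OPTIONS --safe #-}
module Submission where

-- The advice for length n lists the nodes of Bₙ level by level, each as a unary code
-- 1^u₁ 0 1^u₂ 0 1^u₃ 0: an inner node querying x_v has u₁ = v + 1, and u₂, u₃ count the codes
-- that follow it up to its 0- and its 1-successor; a sink has u₁ = 0 and u₂ its output.
-- The machine needs no work tape at all: its only counter, the number of codes still to be
-- skipped, is the position of its input head, and the same head finds x_v by walking v + 1
-- cells. Width 5 keeps every skip count at most 8, so a code has length at most n + 19 and the
-- advice has length at most size · (n + 19) ≤ 2^((log n)^c) · 2^(log n + 1) ≤ 2^((log n)^(c+2)).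

open import Defs
open import Data.Nat using (ℕ; zero; suc; _+_; _*_; _^_; _≤_; _<_; _<?_; z≤n; s≤s; s≤s⁻¹; ⌈_/2⌉)
open import Data.Nat.Properties
open import Data.Bool using (Bool; true; false; if_then_else_)
open import Data.Bool.Properties using (if-float)
open import Data.Vec using (Vec; lookup)
open import Data.List using (List; []; _∷_; length; _++_; replicate; foldr)
open import Data.List.Properties using (foldr-++)
open import Data.Nat.Logarithm using (⌈log₂_⌉; ⌈log₂⌉-mono-≤)
open import Data.Nat.Logarithm.Core using (⌈log2⌉)
open import Data.Nat.Induction using (<-wellFounded)
open import Induction.WellFounded using (Acc; acc)
open import Data.Fin using (Fin; toℕ)
open import Data.Fin.Properties using (toℕ<n; fromℕ<-toℕ)
open import Data.Product using (Σ; ∃; ∃₂; _×_; _,_)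
open import Data.Sum using (_⊎_; inj₁; inj₂)
open import Data.Empty using (⊥-elim)
open import Function using (_∘_)
open import Data.Nat.Tactic.RingSolver using (solve-∀)
open import Relation.Nullary using (yes; no)
open import Relation.Binary.PropositionalEquality

NeverMovesWorkHead : TM → Set
NeverMovesWorkHead M = ∀ q i α w {q′ s mi mα mw} → TM.δ M q i α w ≡ go q′ s mi mα mw → mw ≡ S

module Steps (M : TM) {n : ℕ} (x : Vec Bool n) (a : List Bool) where
  open Config

  next : Config M ⊎ Bool → Config M ⊎ Bool
  next (inj₁ c) = stepTM M x a c
  next (inj₂ b) = inj₂ b

  steps : ℕ → Config M ⊎ Bool → Config M ⊎ Bool
  steps zero    r = r
  steps (suc t) r = next (steps t r)

  exec-suc : ∀ t → exec M x a (suc t) ≡ next (exec M x a t)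
  exec-suc t with exec M x a t
  ... | inj₁ c = refl
  ... | inj₂ b = refl

  exec≡steps : ∀ t → exec M x a t ≡ steps t (inj₁ (initial M))
  exec≡steps zero    = refl
  exec≡steps (suc t) = trans (exec-suc t) (cong next (exec≡steps t))

  steps-+ : ∀ t t′ r → steps (t + t′) r ≡ steps t (steps t′ r)
  steps-+ zero    t′ r = refl
  steps-+ (suc t) t′ r = cong next (steps-+ t t′ r)

  infix 4 _⇝_
  _⇝_ : Config M ⊎ Bool → Config M ⊎ Bool → Set
  r ⇝ r′ = ∃ λ t → steps t r ≡ r′

  ⇝-refl : ∀ {r} → r ⇝ r
  ⇝-refl = 0 , refl

  ⇝-trans : ∀ {r r′ r″} → r ⇝ r′ → r′ ⇝ r″ → r ⇝ r″
  ⇝-trans {r} (t , e) (t′ , e′) = t′ + t , trans (steps-+ t′ t r) (trans (cong (steps t′) e) e′)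

  stepTM⇒⇝ : ∀ {c r} → stepTM M x a c ≡ r → inj₁ c ⇝ r
  stepTM⇒⇝ e = 1 , e

  ⇝⇒Outputs : ∀ {b} → inj₁ (initial M) ⇝ inj₂ b → Outputs M x a b
  ⇝⇒Outputs (t , e) = t , trans (exec≡steps t) e

  module _ (still : NeverMovesWorkHead M) where

    stepTM-workPos : ∀ c {c′} → stepTM M x a c ≡ inj₁ c′ → workPos c′ ≡ workPos c
    stepTM-workPos c e
      with TM.δ M (state c) (readVec x (inPos c)) (readList a (advPos c)) (work c (workPos c)) in eδ
    stepTM-workPos c refl | go q s mi mα mw rewrite still _ _ _ _ eδ = refl

    exec-workPos : ∀ t c → exec M x a t ≡ inj₁ c → workPos c ≡ 0
    exec-workPos zero    c refl = refl
    exec-workPos (suc t) c e with exec M x a t in e₀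
    ... | inj₁ c₀ = trans (stepTM-workPos c₀ e) (exec-workPos t c₀ e₀)

    workBounded : WorkBounded M 0 x a
    workBounded t c e = ≤-reflexive (exec-workPos t c e)

State : Set
State = Fin 12

-- seek skips as many codes as the input head position, passing the three unary blocks of a code
-- in skip₃, skip₂, skip₁; query reads a code, rewind b returns the input head to ⊢ once x_v = b
-- is known, and countOff_b loads the offset of the b-successor into the input head.
pattern init      = Fin.zero
pattern query     = Fin.suc init
pattern rewind₀   = Fin.suc query
pattern rewind₁   = Fin.suc rewind₀
pattern skipOff₀  = Fin.suc rewind₁
pattern countOff₀ = Fin.suc skipOff₀
pattern countOff₁ = Fin.suc countOff₀
pattern skip₃     = Fin.suc countOff₁
pattern skip₂     = Fin.suc skip₃
pattern skip₁     = Fin.suc skip₂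
pattern seek      = Fin.suc skip₁
pattern output    = Fin.suc seek

rewind : Bool → State
rewind false = rewind₀
rewind true  = rewind₁

data Instr : Set where
  stop : Bool → Instr
  goto : State → (inMove advMove : Move) → Instr

instr : State → TSym → TSym → Instr
instr init      _       _           = goto seek S R
instr seek      ⊢       _           = goto query S S
instr seek      _       _           = goto skip₃ L S
instr query     _       (bit true)  = goto query R R
instr query     ⊢       (bit false) = goto output S R
instr query     (bit b) (bit false) = goto (rewind b) L R
instr rewind₀   ⊢       _           = goto countOff₀ S S
instr rewind₀   _       _           = goto rewind₀ L S
instr rewind₁   ⊢       _           = goto skipOff₀ S S
instr rewind₁   _       _           = goto rewind₁ L S
instr countOff₀ _       (bit true)  = goto countOff₀ R R
instr countOff₀ _       (bit false) = goto skip₁ S R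
instr skipOff₀  _       (bit true)  = goto skipOff₀ S R
instr skipOff₀  _       (bit false) = goto countOff₁ S R
instr countOff₁ _       (bit true)  = goto countOff₁ R R
instr countOff₁ _       (bit false) = goto seek S R
instr skip₃     _       (bit true)  = goto skip₃ S R
instr skip₃     _       (bit false) = goto skip₂ S R
instr skip₂     _       (bit true)  = goto skip₂ S R
instr skip₂     _       (bit false) = goto skip₁ S R
instr skip₁     _       (bit true)  = goto skip₁ S R
instr skip₁     _       (bit false) = goto seek S R
instr output    _       (bit b)     = stop b
instr _         _       _           = stop false

toAction : Instr → Action 12 0
toAction (stop b)       = halt b
toAction (goto q mi mα) = go q Fin.zero mi mα S

simulator : TM
simulator = record { Q = 12 ; g = 0 ; start = init ; δ = λ q i α _ → toAction (instr q i α) }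

toAction-still : ∀ ι {q s mi mα mw} → toAction ι ≡ go q s mi mα mw → mw ≡ S
toAction-still (goto q mi mα) refl = refl

simulator-still : NeverMovesWorkHead simulator
simulator-still q i α _ = toAction-still (instr q i α)

Code : Set
Code = ℕ × ℕ × ℕ

unary : Code → List Bool → List Bool
unary (u₁ , u₂ , u₃) bs = replicate u₁ true ++ false ∷ replicate u₂ true ++ false ∷ replicate u₃ true ++ false ∷ bs

-- o is the number of nodes after this one in its level, so the code of the s-successor comes
-- o + s codes further on.
nodeCode : ∀ {n k′} → ℕ → Node n k′ → Code
nodeCode o (inner v s₀ s₁) = suc (toℕ v) , o + toℕ s₀ , o + toℕ s₁
nodeCode o (sink b)        = 0 , (if b then 1 else 0) , 0

levelCodes : ∀ {n k′} k → (Fin k → Node n k′) → List Code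
levelCodes zero    ns = []
levelCodes (suc k) ns = nodeCode k (ns Fin.zero) ∷ levelCodes k (ns ∘ Fin.suc)

advice : ∀ {n k} → BP n k → List Bool
advice {n} (last {k} f) = foldr unary [] (levelCodes {n} {0} k (sink ∘ f))
advice (step {k} ns r)  = foldr unary (advice r) (levelCodes k ns)

length-levelCodes : ∀ {n k′} k (ns : Fin k → Node n k′) → length (levelCodes k ns) ≡ k
length-levelCodes zero    ns = refl
length-levelCodes (suc k) ns = cong suc (length-levelCodes k (ns ∘ Fin.suc))

levelCodes-split : ∀ {n k′} k (ns : Fin k → Node n k′) (j : Fin k) →
                   ∃₂ λ cs ds → levelCodes k ns ≡ cs ++ nodeCode (length ds) (ns j) ∷ ds × length cs ≡ toℕ j
levelCodes-split (suc k) ns Fin.zero =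
  [] , ds , cong (λ o → nodeCode o (ns Fin.zero) ∷ ds) (sym (length-levelCodes k (ns ∘ Fin.suc))) , refl
  where
  ds : List Code
  ds = levelCodes k (ns ∘ Fin.suc)
levelCodes-split (suc k) ns (Fin.suc j) with levelCodes-split k (ns ∘ Fin.suc) j
... | cs , ds , e , l = nodeCode k (ns Fin.zero) ∷ cs , ds , cong (_ ∷_) e , cong suc l

evalNode : ∀ {n k′} → Node n k′ → BP n k′ → Vec Bool n → Bool
evalNode (sink b)        r x = b
evalNode (inner v s₀ s₁) r x = evalFrom r (if lookup x v then s₁ else s₀) x

evalFrom-step : ∀ {n k k′} (ns : Fin k → Node n k′) r j x → evalFrom (step ns r) j x ≡ evalNode (ns j) r x
evalFrom-step ns r j x with ns j
... | sink b        = refl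
... | inner v s₀ s₁ = refl

module Simulation {n : ℕ} (x : Vec Bool n) (a : List Bool) where
  open Steps simulator x a

  Point : Set
  Point = State × ℕ × ℕ

  conf : Point → (ℕ → Fin 1) → Config simulator
  conf (s , i , p) w = record { state = s ; inPos = i ; advPos = p ; workPos = 0 ; work = w }

  infix 4 _↠_ _⇓_
  -- Quantified over work tapes: the machine only writes blanks to cell 0, but the resulting
  -- tape is not definitionally the one it started with.
  _↠_ : Point → Point → Set
  P ↠ P′ = ∀ w → ∃ λ w′ → inj₁ (conf P w) ⇝ inj₁ (conf P′ w′)

  _⇓_ : Point → Bool → Set
  P ⇓ b = ∀ w → inj₁ (conf P w) ⇝ inj₂ b

  ↠-refl : ∀ {P} → P ↠ P
  ↠-refl w = w , ⇝-refl

  infixr 5 _⨾_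
  infixr 4 _⨾⇓_
  _⨾_ : ∀ {P Q R} → P ↠ Q → Q ↠ R → P ↠ R
  (f ⨾ g) w with f w
  ... | w₁ , r₁ with g w₁
  ... | w₂ , r₂ = w₂ , ⇝-trans r₁ r₂

  _⨾⇓_ : ∀ {P Q b} → P ↠ Q → Q ⇓ b → P ⇓ b
  (f ⨾⇓ h) w with f w
  ... | w₁ , r₁ = ⇝-trans r₁ (h w₁)

  instrAt : Point → Instr
  instrAt (s , i , p) = instr s (readVec x i) (readList a p)

  stepTM-goto : ∀ {s i p s′ mi mα} w → instrAt (s , i , p) ≡ goto s′ mi mα →
                stepTM simulator x a (conf (s , i , p) w)
                  ≡ inj₁ (conf (s′ , move mi i , move mα p) (write simulator w 0 Fin.zero))
  stepTM-goto {s} {i} {p} w e with instrAt (s , i , p) | e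
  ... | _ | refl = refl

  stepTM-stop : ∀ {s i p b} w → instrAt (s , i , p) ≡ stop b → stepTM simulator x a (conf (s , i , p) w) ≡ inj₂ b
  stepTM-stop {s} {i} {p} w e with instrAt (s , i , p) | e
  ... | _ | refl = refl

  ↠-step : ∀ {s i p s′ mi mα} → instrAt (s , i , p) ≡ goto s′ mi mα → (s , i , p) ↠ (s′ , move mi i , move mα p)
  ↠-step e w = _ , stepTM⇒⇝ (stepTM-goto w e)

  ⇓-step : ∀ {s i p b} → instrAt (s , i , p) ≡ stop b → (s , i , p) ⇓ b
  ⇓-step e w = stepTM⇒⇝ (stepTM-stop w e)

  AdviceAt : ℕ → List Bool → Set
  AdviceAt p bs = ∀ q → readList a (p + q) ≡ readList bs (suc q)

  adviceAt-start : AdviceAt 1 a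
  adviceAt-start q = refl

  adviceAt-head : ∀ {p b bs} → AdviceAt p (b ∷ bs) → readList a p ≡ bit b
  adviceAt-head {p} h = trans (cong (readList a) (sym (+-identityʳ p))) (h 0)

  adviceAt-tail : ∀ {p b bs} → AdviceAt p (b ∷ bs) → AdviceAt (suc p) bs
  adviceAt-tail {p} h q = trans (cong (readList a) (sym (+-suc p q))) (h (suc q))

  Situation : Set
  Situation = State × ℕ × List Bool

  at : Situation → ℕ → Point
  at (s , i , _) p = s , i , p

  rest : Situation → List Bool
  rest (_ , _ , bs) = bs

  infix 4 _⟶_ _⇓ᵃ_
  record _⟶_ (σ τ : Situation) : Set where
    constructor scan
    field run : ∀ {p} → AdviceAt p (rest σ) → ∃ λ p′ → AdviceAt p′ (rest τ) × at σ p ↠ at τ p′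

  record _⇓ᵃ_ (σ : Situation) (b : Bool) : Set where
    constructor scan⇓
    field run⇓ : ∀ {p} → AdviceAt p (rest σ) → at σ p ⇓ b

  open _⟶_
  open _⇓ᵃ_

  ⟶-refl : ∀ {σ} → σ ⟶ σ
  ⟶-refl = scan λ h → _ , h , ↠-refl

  infixr 5 _⟫_
  infixr 4 _⟫⇓_
  _⟫_ : ∀ {σ τ υ} → σ ⟶ τ → τ ⟶ υ → σ ⟶ υ
  f ⟫ g = scan λ h → let (_ , h₁ , r₁) = run f h ; (p₂ , h₂ , r₂) = run g h₁ in p₂ , h₂ , r₁ ⨾ r₂

  _⟫⇓_ : ∀ {σ τ b} → σ ⟶ τ → τ ⇓ᵃ b → σ ⇓ᵃ b
  f ⟫⇓ g = scan⇓ λ h → let (_ , h₁ , r₁) = run f h in r₁ ⨾⇓ run⇓ g h₁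

  moveInput : ∀ {s i bs s′ mi} → (∀ α → instr s (readVec x i) α ≡ goto s′ mi S) →
              (s , i , bs) ⟶ (s′ , move mi i , bs)
  moveInput H = scan λ h → _ , h , ↠-step (H _)

  readBit : ∀ {s i b bs s′ mi} → instr s (readVec x i) (bit b) ≡ goto s′ mi R →
            (s , i , b ∷ bs) ⟶ (s′ , move mi i , bs)
  readBit {s} {i} e = scan λ {p} h →
    suc p , adviceAt-tail {p} h , ↠-step (trans (cong (instr s (readVec x i)) (adviceAt-head {p} h)) e)

  stopOn : ∀ {s i b bs b′} → instr s (readVec x i) (bit b) ≡ stop b′ → (s , i , b ∷ bs) ⇓ᵃ b′
  stopOn {s} {i} e = scan⇓ λ {p} h → ⇓-step (trans (cong (instr s (readVec x i)) (adviceAt-head {p} h)) e)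

  countOnes : ∀ {s bs} → (∀ I → instr s I (bit true) ≡ goto s R R) →
              ∀ m i → (s , i , replicate m true ++ bs) ⟶ (s , i + m , bs)
  countOnes {s} {bs} H zero i = subst (λ j → (s , i , bs) ⟶ (s , j , bs)) (sym (+-identityʳ i)) ⟶-refl
  countOnes {s} {bs} H (suc m) i =
    readBit (H _) ⟫ subst (λ j → (s , suc i , replicate m true ++ bs) ⟶ (s , j , bs))
                          (sym (+-suc i m)) (countOnes H m (suc i))

  skipOnes : ∀ {s bs} → (∀ I → instr s I (bit true) ≡ goto s S R) →
             ∀ m i → (s , i , replicate m true ++ bs) ⟶ (s , i , bs)
  skipOnes H zero    i = ⟶-refl
  skipOnes H (suc m) i = readBit (H _) ⟫ skipOnes H m i

  beyond⊢ : ∀ {X : Set} (f : TSym → X) {y} → f ⊣ ≡ y → (∀ b → f (bit b) ≡ y) → ∀ m → f (readVec x (suc m)) ≡ y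
  beyond⊢ f e⊣ ebit m with m <? n
  ... | yes _ = ebit _
  ... | no  _ = e⊣

  readVec-var : ∀ v → readVec x (suc (toℕ v)) ≡ bit (lookup x v)
  readVec-var v with toℕ v <? n
  ... | yes v<n = cong (bit ∘ lookup x) (fromℕ<-toℕ v v<n)
  ... | no  v≮n = ⊥-elim (v≮n (toℕ<n v))

  rewindStep : ∀ b i {bs} → (rewind b , suc i , bs) ⟶ (rewind b , i , bs)
  rewindStep false i = moveInput (λ α → beyond⊢ (λ I → instr rewind₀ I α) refl (λ _ → refl) i)
  rewindStep true  i = moveInput (λ α → beyond⊢ (λ I → instr rewind₁ I α) refl (λ _ → refl) i)

  rewinding : ∀ b i {bs} → (rewind b , i , bs) ⟶ (rewind b , 0 , bs)
  rewinding b zero    = ⟶-refl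
  rewinding b (suc i) = rewindStep b i ⟫ rewinding b i

  afterRewind : ∀ b u₀ u₁ {bs} →
                (rewind b , 0 , replicate u₀ true ++ false ∷ replicate u₁ true ++ false ∷ bs)
                  ⟶ (seek , (if b then u₁ else u₀) , bs)
  afterRewind false u₀ u₁ =
    moveInput (λ _ → refl) ⟫ countOnes (λ _ → refl) u₀ 0 ⟫ readBit refl
      ⟫ skipOnes (λ _ → refl) u₁ u₀ ⟫ readBit refl
  afterRewind true u₀ u₁ =
    moveInput (λ _ → refl) ⟫ skipOnes (λ _ → refl) u₀ 0 ⟫ readBit refl
      ⟫ countOnes (λ _ → refl) u₁ 0 ⟫ readBit refl

  queryInner : ∀ v u₀ u₁ {bs} →
               (query , 0 , unary (suc (toℕ v) , u₀ , u₁) bs) ⟶ (seek , (if lookup x v then u₁ else u₀) , bs)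
  queryInner v u₀ u₁ =
    countOnes (λ _ → refl) (suc (toℕ v)) 0 ⟫ readBit (cong (λ I → instr query I (bit false)) (readVec-var v))
      ⟫ rewinding (lookup x v) (toℕ v) ⟫ afterRewind (lookup x v) u₀ u₁

  querySink : ∀ b u {bs} → (query , 0 , unary (0 , (if b then 1 else 0) , u) bs) ⇓ᵃ b
  querySink false u = readBit refl ⟫⇓ stopOn refl
  querySink true  u = readBit refl ⟫⇓ stopOn refl

  skipCode : ∀ c i {bs} → (skip₃ , i , unary c bs) ⟶ (seek , i , bs)
  skipCode (u₁ , u₂ , u₃) i =
    skipOnes (λ _ → refl) u₁ i ⟫ readBit refl ⟫ skipOnes (λ _ → refl) u₂ i ⟫ readBit refl
      ⟫ skipOnes (λ _ → refl) u₃ i ⟫ readBit refl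

  seekPast : ∀ cs m {bs} → (seek , length cs + m , foldr unary bs cs) ⟶ (seek , m , bs)
  seekPast []       m = ⟶-refl
  seekPast (c ∷ cs) m =
    moveInput (λ α → beyond⊢ (λ I → instr seek I α) refl (λ _ → refl) (length cs + m))
      ⟫ skipCode c _ ⟫ seekPast cs m

  seekNode : ∀ {k k′ b bs} (ns : Fin k → Node n k′) (j : Fin k) →
             (∀ ds → (query , 0 , unary (nodeCode (length ds) (ns j)) (foldr unary bs ds)) ⇓ᵃ b) →
             (seek , toℕ j , foldr unary bs (levelCodes k ns)) ⇓ᵃ b
  seekNode {k} {bs = bs} ns j atNode with levelCodes-split k ns j
  ... | cs , ds , e , l rewrite e | foldr-++ unary bs cs (nodeCode (length ds) (ns j) ∷ ds) | sym l =
    subst (λ i → (seek , i , foldr unary node cs) ⟶ (seek , 0 , node)) (+-identityʳ (length cs)) (seekPast cs 0)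
      ⟫ moveInput (λ _ → refl) ⟫⇓ atNode ds
    where
    node : List Bool
    node = unary (nodeCode (length ds) (ns j)) (foldr unary bs ds)

  mutual
    seekLevel : ∀ {k} (r : BP n k) (j : Fin k) → (seek , toℕ j , advice r) ⇓ᵃ evalFrom r j x
    seekLevel (last f)    j = seekNode (sink ∘ f) j (λ _ → querySink (f j) 0)
    seekLevel (step ns r) j =
      subst ((seek , toℕ j , advice (step ns r)) ⇓ᵃ_) (sym (evalFrom-step ns r j x))
            (seekNode ns j (queryNode (ns j) r))

    queryNode : ∀ {k′} (nd : Node n k′) (r : BP n k′) ds →
                (query , 0 , unary (nodeCode (length ds) nd) (foldr unary (advice r) ds)) ⇓ᵃ evalNode nd r x
    queryNode (sink b)        r ds = querySink b 0
    queryNode (inner v s₀ s₁) r ds =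
      subst (λ i → (query , 0 , unary (nodeCode (length ds) (inner v s₀ s₁)) bs) ⟶ (seek , i , bs))
            (sym (if-float (λ s → length ds + toℕ s) (lookup x v))) (queryInner v _ _)
        ⟫ seekPast ds _ ⟫⇓ seekLevel r _
      where
      bs : List Bool
      bs = foldr unary (advice r) ds

simulator-outputs : ∀ {n} (B : BranchingProgram n) x → Outputs simulator x (advice B) (eval B x)
simulator-outputs B x = ⇝⇒Outputs ((↠-step refl ⨾⇓ run⇓ (seekLevel B Fin.zero) adviceAt-start) (λ _ → Fin.zero))
  where
  open Simulation x (advice B)
  open Steps simulator x (advice B)
  open _⇓ᵃ_

codeLength : Code → ℕ
codeLength (u₁ , u₂ , u₃) = u₁ + u₂ + u₃ + 3

length-block : ∀ u bs → length (replicate u true ++ false ∷ bs) ≡ u + suc (length bs)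
length-block zero    bs = refl
length-block (suc u) bs = cong suc (length-block u bs)

length-unary : ∀ c bs → length (unary c bs) ≡ codeLength c + length bs
length-unary (u₁ , u₂ , u₃) bs = begin
  length (unary (u₁ , u₂ , u₃) bs)
    ≡⟨ length-block u₁ _ ⟩
  u₁ + suc (length (replicate u₂ true ++ _))
    ≡⟨ cong (λ l → u₁ + suc l) (length-block u₂ _) ⟩
  u₁ + suc (u₂ + suc (length (replicate u₃ true ++ _)))
    ≡⟨ cong (λ l → u₁ + suc (u₂ + suc l)) (length-block u₃ bs) ⟩
  u₁ + suc (u₂ + suc (u₃ + suc (length bs)))
    ≡⟨ regroup u₁ u₂ u₃ (length bs) ⟩
  u₁ + u₂ + u₃ + 3 + length bs
    ∎
  where
  open ≡-Reasoning
  regroup : ∀ u₁ u₂ u₃ l → u₁ + suc (u₂ + suc (u₃ + suc l)) ≡ u₁ + u₂ + u₃ + 3 + l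
  regroup = solve-∀

nodeCode-length : ∀ {n k′} o (nd : Node n k′) → o ≤ 4 → k′ ≤ 5 → codeLength (nodeCode o nd) ≤ n + 19
nodeCode-length {n} o (inner v s₀ s₁) o≤4 k′≤5 = begin
  suc (toℕ v) + (o + toℕ s₀) + (o + toℕ s₁) + 3 ≤⟨ +-monoˡ-≤ 3 (+-mono-≤ (+-mono-≤ (toℕ<n v) (offset s₀))
                                                                           (offset s₁)) ⟩
  n + 8 + 8 + 3                                  ≡⟨ cong (_+ 3) (+-assoc n 8 8) ⟩
  n + 16 + 3                                     ≡⟨ +-assoc n 16 3 ⟩
  n + 19                                         ∎
  where
  open ≤-Reasoning
  offset : (s : Fin _) → o + toℕ s ≤ 8
  offset s = +-mono-≤ o≤4 (s≤s⁻¹ (≤-trans (toℕ<n s) k′≤5))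
nodeCode-length {n} o (sink true)  _ _ = ≤-trans (m≤m+n 4 15) (m≤n+m 19 n)
nodeCode-length {n} o (sink false) _ _ = ≤-trans (m≤m+n 3 16) (m≤n+m 19 n)

length-levelAdvice : ∀ {n k′} k (ns : Fin k → Node n k′) bs → k ≤ 5 → k′ ≤ 5 →
                     length (foldr unary bs (levelCodes k ns)) ≤ k * (n + 19) + length bs
length-levelAdvice zero ns bs _ _ = ≤-refl
length-levelAdvice {n} (suc k) ns bs k<5 k′≤5 = begin
  length (unary (nodeCode k (ns Fin.zero)) rest)
    ≡⟨ length-unary (nodeCode k (ns Fin.zero)) rest ⟩
  codeLength (nodeCode k (ns Fin.zero)) + length rest
    ≤⟨ +-mono-≤ (nodeCode-length k (ns Fin.zero) (s≤s⁻¹ k<5) k′≤5)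
                (length-levelAdvice k (ns ∘ Fin.suc) bs (≤-trans (n≤1+n k) k<5) k′≤5) ⟩
  n + 19 + (k * (n + 19) + length bs)
    ≡⟨ +-assoc (n + 19) (k * (n + 19)) (length bs) ⟨
  suc k * (n + 19) + length bs
    ∎
  where
  open ≤-Reasoning
  rest : List Bool
  rest = foldr unary bs (levelCodes k (ns ∘ Fin.suc))

k≤width : ∀ {n k} (r : BP n k) → k ≤ width r
k≤width (last f)    = ≤-refl
k≤width (step ns r) = m≤m⊔n _ _

length-advice : ∀ {n k} (r : BP n k) → width r ≤ 5 → length (advice r) ≤ size r * (n + 19)
length-advice {n} (last {k} f) k≤5 = begin
  length (advice (last f)) ≤⟨ length-levelAdvice k (sink ∘ f) [] k≤5 z≤n ⟩
  k * (n + 19) + 0         ≡⟨ +-identityʳ _ ⟩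
  k * (n + 19)             ∎
  where open ≤-Reasoning
length-advice {n} (step {k} ns r) w≤5 = begin
  length (advice (step ns r))          ≤⟨ length-levelAdvice k ns (advice r) (≤-trans (m≤m⊔n k _) w≤5)
                                                                             (≤-trans (k≤width r) r≤5) ⟩
  k * (n + 19) + length (advice r)     ≤⟨ +-monoʳ-≤ (k * (n + 19)) (length-advice r r≤5) ⟩
  k * (n + 19) + size r * (n + 19)     ≡⟨ *-distribʳ-+ (n + 19) k (size r) ⟨
  (k + size r) * (n + 19)              ∎
  where
  open ≤-Reasoning
  r≤5 : width r ≤ 5
  r≤5 = ≤-trans (m≤n⊔m k (width r)) w≤5

m≤⌈m/2⌉+⌈m/2⌉ : ∀ m → m ≤ ⌈ m /2⌉ + ⌈ m /2⌉
m≤⌈m/2⌉+⌈m/2⌉ m = ≤-trans (≤-reflexive (sym (⌊n/2⌋+⌈n/2⌉≡n m))) (+-monoˡ-≤ ⌈ m /2⌉ (⌊n/2⌋≤⌈n/2⌉ m))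

n≤2^⌈log2⌉ : ∀ n (rec : Acc _<_ n) → n ≤ 2 ^ ⌈log2⌉ n rec
n≤2^⌈log2⌉ zero          _        = z≤n
n≤2^⌈log2⌉ (suc zero)    _        = ≤-refl
n≤2^⌈log2⌉ (suc (suc m)) (acc rs) = begin
  2 + m                        ≤⟨ +-monoʳ-≤ 2 (m≤⌈m/2⌉+⌈m/2⌉ m) ⟩
  2 + (h + h)                  ≡⟨ double h ⟩
  2 * suc h                    ≤⟨ *-monoʳ-≤ 2 (n≤2^⌈log2⌉ (suc h) (rs _)) ⟩
  2 * 2 ^ ⌈log2⌉ (suc h) (rs _) ∎
  where
  open ≤-Reasoning
  h : ℕ
  h = ⌈ m /2⌉
  double : ∀ h → 2 + (h + h) ≡ 2 * suc h
  double = solve-∀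

n≤2^⌈log₂n⌉ : ∀ n → n ≤ 2 ^ ⌈log₂ n ⌉
n≤2^⌈log₂n⌉ n = n≤2^⌈log2⌉ n (<-wellFounded n)

n+19≤2^[1+⌈log₂n⌉] : ∀ n → 19 ≤ n → n + 19 ≤ 2 ^ suc ⌈log₂ n ⌉
n+19≤2^[1+⌈log₂n⌉] n 19≤n = begin
  n + 19          ≤⟨ +-monoʳ-≤ n 19≤n ⟩
  n + n           ≡⟨ cong (n +_) (+-identityʳ n) ⟨
  2 * n           ≤⟨ *-monoʳ-≤ 2 (n≤2^⌈log₂n⌉ n) ⟩
  2 * 2 ^ ⌈log₂ n ⌉ ∎
  where open ≤-Reasoning

ℓ^c+[1+ℓ]≤ℓ^[c+2] : ∀ ℓ c → 2 ≤ ℓ → ℓ ^ c + suc ℓ ≤ ℓ ^ (c + 2)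
ℓ^c+[1+ℓ]≤ℓ^[c+2] ℓ@(suc (suc m)) c (s≤s (s≤s _)) = begin
  ℓ ^ c + suc ℓ           ≤⟨ +-monoʳ-≤ (ℓ ^ c) (m≤n*m (suc ℓ) (ℓ ^ c) {{m^n≢0 ℓ c}}) ⟩
  ℓ ^ c + ℓ ^ c * suc ℓ   ≡⟨ factor (ℓ ^ c) ℓ ⟩
  ℓ ^ c * (2 + ℓ)         ≤⟨ *-monoʳ-≤ (ℓ ^ c) (≤-trans (m≤m+n (4 + m) (m * (3 + m))) (≤-reflexive (square m))) ⟩
  ℓ ^ c * ℓ ^ 2           ≡⟨ ^-distribˡ-+-* ℓ c 2 ⟨
  ℓ ^ (c + 2)             ∎
  where
  open ≤-Reasoning
  factor : ∀ X ℓ → X + X * suc ℓ ≡ X * (2 + ℓ)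
  factor = solve-∀
  square : ∀ m → 4 + m + m * (3 + m) ≡ (2 + m) * ((2 + m) * 1)
  square = solve-∀

length-advice≤qpoly : ∀ {n} c (B : BranchingProgram n) → width B ≤ 5 → size B ≤ qpoly c n → 19 ≤ n →
                      length (advice B) ≤ qpoly (c + 2) n
length-advice≤qpoly {n} c B w≤5 size≤ 19≤n = begin
  length (advice B)         ≤⟨ length-advice B w≤5 ⟩
  size B * (n + 19)         ≤⟨ *-mono-≤ size≤ (n+19≤2^[1+⌈log₂n⌉] n 19≤n) ⟩
  2 ^ (ℓ ^ c) * 2 ^ suc ℓ   ≡⟨ ^-distribˡ-+-* 2 (ℓ ^ c) (suc ℓ) ⟨
  2 ^ (ℓ ^ c + suc ℓ)       ≤⟨ ^-monoʳ-≤ 2 (ℓ^c+[1+ℓ]≤ℓ^[c+2] ℓ c (≤-trans (m≤m+n 2 3) (⌈log₂⌉-mono-≤ 19≤n))) ⟩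
  2 ^ (ℓ ^ (c + 2))         ∎
  where
  open ≤-Reasoning
  ℓ : ℕ
  ℓ = ⌈log₂ n ⌉

lemma4 : (B : (n : ℕ) → BranchingProgram n)
    → (∀ n → width (B n) ≤ 5)
    → (∃ λ c → Eventually (λ n → size (B n) ≤ qpoly c n))
    → Σ TM λ M → ∃ λ K → ∃ λ c' → Σ ((n : ℕ) → List Bool) λ a →
        Eventually (λ n → length (a n) ≤ qpoly c' n)
        × (∀ n (x : Vec Bool n) → WorkBounded M K x (a n))
        × (∀ n (x : Vec Bool n) → Outputs M x (a n) (eval (B n) x))
lemma4 B width≤5 (c , N , size≤) =
  simulator , 0 , c + 2 , (λ n → advice (B n)) , (N + 19 , short) ,
  (λ n x → Steps.workBounded simulator x (advice (B n)) simulator-still) ,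
  (λ n x → simulator-outputs (B n) x)
  where
  short : ∀ n → N + 19 ≤ n → length (advice (B n)) ≤ qpoly (c + 2) n
  short n N+19≤n = length-advice≤qpoly c (B n) (width≤5 n) (size≤ n (m+n≤o⇒m≤o N N+19≤n)) (m+n≤o⇒n≤o N N+19≤n)
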